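{- Let $\mathcal{M}$ be a finite unitary magma and let $\mathcal{A}$ be an associative algebra over $\mathbb{K}$ with product $\odot$, together with linear maps $\omega_x:\mathcal{A}\to\mathcal{A}$, $x\in\mathcal{M}$, such that $\omega_{1_\mathcal{M}}=\mathrm{Id}_\mathcal{A}$ and $\omega_x\circ\omega_y=\omega_{x\star y}$ for all $x,y\in\mathcal{M}$. Then $\mathcal{A}$ is an $\mathrm{NC}\mathcal{M}$-algebra in which each $\mathcal{M}$-triangle $\mathfrak{p}$ (with base label $\mathfrak{p}_0$, first edge label $\mathfrak{p}_1$, second edge label $\mathfrak{p}_2$) acts by the binary operation $a_1\otimes a_2\mapsto \omega_{\mathfrak{p}_0}\big(\omega_{\mathfrak{p}_1}(a_1)\odot\omega_{\mathfrak{p}_2}(a_2)\big)$.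
   Context: $\mathbb{K}$ is a field of characteristic zero. A unitary magma $\mathcal{M}$ is a set with a binary operation $\star$ and two-sided unit $1_\mathcal{M}$. For $n\ge1$, an $\mathcal{M}$-clique of arity $n$ labels each arc $(x,y)$, $1\le x<y\le n+1$, of a polygon with vertices $1,\dots,n+1$ by an element of $\mathcal{M}$; base $(1,n+1)$, edges $(i,i+1)$, other arcs diagonals; $\mathfrak{p}_0$ is the base label, $\mathfrak{p}_i$ the label of edge $(i,i+1)$; exactly one clique in arity 1 (the unit). Solid arc: label $\neq1_\mathcal{M}$; noncrossing: no two solid diagonals $(x,y),(x',y')$ with $x<x'<y<y'$ or $x'<x<y'<y$. The partial composition $\mathfrak{p}\circ_i\mathfrak{q}$ ($\mathfrak{p}$ of arity $n$, $\mathfrak{q}$ of arity $m$, $i\in[n]$) glues the base of $\mathfrak{q}$ onto the $i$th edge of $\mathfrak{p}$, keeping the labels of the arcs of $\mathfrak{p}$ (vertices $>i$ shifted by $m-1$) and of $\mathfrak{q}$ (vertices shifted by $i-1$), labeling the common arc $(i,i+m)$ by $\mathfrak{p}_i\star\mathfrak{q}_0$ and all other arcs by $1_\mathcal{M}$. $\mathrm{NC}\mathcal{M}$ is the operad spanned by noncrossing $\mathcal{M}$-cliques with this composition; it is generated by the $\mathcal{M}$-triangles (cliques of arity 2). An $\mathrm{NC}\mathcal{M}$-algebra is a vector space with a linear action $\mathrm{NC}\mathcal{M}(n)\otimes\mathcal{A}^{\otimes n}\to\mathcal{A}$ compatible with partial compositions in the usual way. -}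

module Defs where

open import Level using (Level; _⊔_) renaming (suc to lsuc)
open import Data.Nat using (ℕ; zero; suc; _+_; _∸_; _<_; _≤_; _<?_; _<ᵇ_; _≤ᵇ_; _≡ᵇ_)
open import Data.Nat.Properties using ()
open import Data.Bool using (Bool; true; false; if_then_else_; _∧_; _∨_)
open import Data.Fin as Fin using (Fin; toℕ; fromℕ<; _≟_)
open import Data.Fin.Properties using (toℕ-fromℕ<)
open import Data.Product using (Σ; ∃; _×_; _,_; proj₁; proj₂)
open import Relation.Nullary using (¬_; yes; no)
open import Relation.Binary.PropositionalEquality using (_≡_; subst; sym)
open import Function.Bundles using (_↔_)
open import Algebra.Bundles using (CommutativeRing)
open import Algebra.Module.Bundles using (Module)

module _ {c ℓ : Level} (K : CommutativeRing c ℓ) where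
  open CommutativeRing K using (Carrier; _≈_; 0#; 1#) renaming (_+_ to _+K_; _*_ to _*K_)

  natK : ℕ → Carrier
  natK zero    = 0#
  natK (suc n) = 1# +K natK n

  record IsFieldOfCharZero : Set (c ⊔ ℓ) where
    field
      0≉1       : ¬ (0# ≈ 1#)
      inverse   : ∀ x → ¬ (x ≈ 0#) → Σ Carrier (λ y → (x *K y) ≈ 1#)
      charZero  : ∀ n → ¬ (natK (suc n) ≈ 0#)

record AssocAlgebra {c ℓ : Level} (K : CommutativeRing c ℓ) (a ℓa : Level)
       : Set (c ⊔ ℓ ⊔ lsuc (a ⊔ ℓa)) where
  open CommutativeRing K using (Carrier)
  field
    module′ : Module K a ℓa
  open Module module′ public
  infixl 7 _⊙_
  field
    _⊙_       : Carrierᴹ → Carrierᴹ → Carrierᴹ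
    ⊙-cong    : ∀ {x x′ y y′} → x ≈ᴹ x′ → y ≈ᴹ y′ → (x ⊙ y) ≈ᴹ (x′ ⊙ y′)
    ⊙-assoc   : ∀ x y z → ((x ⊙ y) ⊙ z) ≈ᴹ (x ⊙ (y ⊙ z))
    ⊙-distribʳ : ∀ x y z → ((x +ᴹ y) ⊙ z) ≈ᴹ ((x ⊙ z) +ᴹ (y ⊙ z))
    ⊙-distribˡ : ∀ x y z → (z ⊙ (x +ᴹ y)) ≈ᴹ ((z ⊙ x) +ᴹ (z ⊙ y))
    ⊙-scalarˡ  : ∀ (λ′ : Carrier) x y → ((λ′ *ₗ x) ⊙ y) ≈ᴹ (λ′ *ₗ (x ⊙ y))
    ⊙-scalarʳ  : ∀ (λ′ : Carrier) x y → (x ⊙ (λ′ *ₗ y)) ≈ᴹ (λ′ *ₗ (x ⊙ y))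

module _ {c ℓ a ℓa : Level} {K : CommutativeRing c ℓ} (A : AssocAlgebra K a ℓa) where
  open AssocAlgebra A
  record IsLinear (f : Carrierᴹ → Carrierᴹ) : Set (c ⊔ a ⊔ ℓa) where
    field
      cong     : ∀ {x y} → x ≈ᴹ y → f x ≈ᴹ f y
      additive : ∀ x y → f (x +ᴹ y) ≈ᴹ (f x +ᴹ f y)
      homog    : ∀ λ′ x → f (λ′ *ₗ x) ≈ᴹ (λ′ *ₗ f x)

record UnitaryMagma (m : Level) : Set (lsuc m) where
  infixl 7 _⋆_
  field
    Carrier : Set m
    _⋆_     : Carrier → Carrier → Carrier
    𝟙       : Carrier
    identityˡ : ∀ x → (𝟙 ⋆ x) ≡ x
    identityʳ : ∀ x → (x ⋆ 𝟙) ≡ x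

Finite : {m : Level} → UnitaryMagma m → Set m
Finite M = Σ ℕ (λ k → UnitaryMagma.Carrier M ↔ Fin k)

-- An 𝓜-clique of arity n has vertices 0,…,n (0-based; paper vertex v is
-- our v−1).  Arcs are pairs (x,y) with x < y ≤ n; we encode an arc by its
-- upper end y : Fin (suc n) and its lower end x : Fin (toℕ y), so that
-- there are no junk entries.

module Cliques {m : Level} (𝓜 : UnitaryMagma m) where
  open UnitaryMagma 𝓜

  Clique : ℕ → Set m
  Clique n = (y : Fin (suc n)) → Fin (toℕ y) → Carrier

  -- label of the arc (x,y) given by naturals; 𝟙 if (x,y) is not an arc
  lab : ∀ {n} → Clique n → ℕ → ℕ → Carrier
  lab {n} p x y with y <? suc n | x <? y
  ... | yes y<n | yes x<y =
        p (fromℕ< y<n) (fromℕ< (subst (x <_) (sym (toℕ-fromℕ< y<n)) x<y))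
  ... | _ | _ = 𝟙

  mk : ∀ {n} → (ℕ → ℕ → Carrier) → Clique n
  mk f y x = f (toℕ x) (toℕ y)

  Solid : Carrier → Set m
  Solid z = ¬ (z ≡ 𝟙)

  -- No two solid diagonals (x,y), (x′,y′) cross, i.e. x < x′ < y < y′
  -- (the case x′ < x < y′ < y is the same condition with the roles swapped,
  -- and arcs in crossing position are automatically diagonals).
  -- In arity 1 there is exactly one clique, the unit, whose unique arc
  -- carries the label 𝟙.
  NonCrossing : ∀ {n} → Clique n → Set m
  NonCrossing {n} p =
      (n ≡ 1 → lab p 0 1 ≡ 𝟙)
    × (∀ x y x′ y′ → x < x′ → x′ < y → y < y′ → y′ ≤ n →
         ¬ (Solid (lab p x y) × Solid (lab p x′ y′)))

  NCClique : ℕ → Set m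
  NCClique n = Σ (Clique n) NonCrossing

  unitClique : Clique 1
  unitClique _ _ = 𝟙

  -- Partial composition p ∘_(i+1) q (0-based edge index i, q of arity k),
  -- as a labelling of pairs of naturals (the result has arity n + k − 1):
  -- * the common arc (i, i+k) gets p_(i+1) ⋆ q_0,
  -- * arcs inside [i, i+k] are arcs of q shifted by i,
  -- * arcs with both ends in {0..i} ∪ {i+k, …} are arcs of p
  --   (vertices > i shifted by k − 1),
  -- * all other arcs get 𝟙.
  compLab : ∀ {n k} → Clique n → ℕ → Clique k → ℕ → ℕ → Carrier
  compLab {n} {k} p i q x y =
    if (x ≡ᵇ i) ∧ (y ≡ᵇ (i + k)) then (lab p i (suc i) ⋆ lab q 0 k)
    else if (i ≤ᵇ x) ∧ (y ≤ᵇ (i + k)) then lab q (x ∸ i) (y ∸ i)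
    else if outside x ∧ outside y then lab p (unshift x) (unshift y)
    else 𝟙
    where
      outside : ℕ → Bool
      outside v = (v ≤ᵇ i) ∨ ((i + k) ≤ᵇ v)
      unshift : ℕ → ℕ
      unshift v = if v ≤ᵇ i then v else v ∸ (k ∸ 1)

  comp : ∀ {a b} → Clique (suc a) → Fin (suc a) → Clique (suc b) → Clique (suc (a + b))
  comp p i q = mk (compLab p (toℕ i) q)

-- NC𝓜-algebra structures on an associative algebra A.
-- A linear action NC𝓜(n) ⊗ A^{⊗n} → A is the same as a multilinear map
-- A^n → A for every basis element (noncrossing clique) of NC𝓜(n).

module _ {c ℓ a ℓa m : Level} {K : CommutativeRing c ℓ}
         (𝓜 : UnitaryMagma m) (A : AssocAlgebra K a ℓa) where
  open AssocAlgebra A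
  open UnitaryMagma 𝓜 using (𝟙)
  open Cliques 𝓜

  _[_≔_] : ∀ {n} → (Fin n → Carrierᴹ) → Fin n → Carrierᴹ → (Fin n → Carrierᴹ)
  (as [ j ≔ b ]) t with t ≟ j
  ... | yes _ = b
  ... | no  _ = as t

  -- reading an argument list at a natural index (never out of range below)
  at : ∀ {n} → (Fin n → Carrierᴹ) → ℕ → Carrierᴹ
  at {n} as t with t <? n
  ... | yes t<n = as (fromℕ< t<n)
  ... | no  _   = 0ᴹ

  slice : ∀ {N} (k : ℕ) → (Fin N → Carrierᴹ) → ℕ → (Fin k → Carrierᴹ)
  slice k as i t = at as (i + toℕ t)

  -- a_1,…,a_{i}, b, a_{i+k+1}, …   (0-based index i gets b)
  plug : ∀ {N n} → (Fin N → Carrierᴹ) → ℕ → ℕ → Carrierᴹ → (Fin n → Carrierᴹ)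
  plug as i k b j =
    if toℕ j <ᵇ i then at as (toℕ j)
    else if toℕ j ≡ᵇ i then b
    else at as (toℕ j + k ∸ 1)

  Action : Set (m ⊔ a)
  Action = ∀ {n} → NCClique (suc n) → (Fin (suc n) → Carrierᴹ) → Carrierᴹ

  record IsNCAlgebra (act : Action) : Set (lsuc (m ⊔ a ⊔ ℓa) ⊔ c) where
    field
      act-clique : ∀ {n} (p q : NCClique (suc n)) →
                   (∀ y x → proj₁ p y x ≡ proj₁ q y x) →
                   ∀ as → act p as ≈ᴹ act q as
      act-cong   : ∀ {n} (p : NCClique (suc n)) as bs →
                   (∀ t → as t ≈ᴹ bs t) → act p as ≈ᴹ act p bs
      act-+      : ∀ {n} (p : NCClique (suc n)) as j b b′ →
                   act p (as [ j ≔ b +ᴹ b′ ]) ≈ᴹ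
                   (act p (as [ j ≔ b ]) +ᴹ act p (as [ j ≔ b′ ]))
      act-*      : ∀ {n} (p : NCClique (suc n)) as j λ′ b →
                   act p (as [ j ≔ λ′ *ₗ b ]) ≈ᴹ (λ′ *ₗ act p (as [ j ≔ b ]))
      act-unit   : ∀ (r : NonCrossing unitClique) as →
                   act {0} (unitClique , r) as ≈ᴹ as Fin.zero
      act-comp   : ∀ {n k} (p : NCClique (suc n)) (i : Fin (suc n))
                     (q : NCClique (suc k))
                     (r : NonCrossing (comp (proj₁ p) i (proj₁ q)))
                     (as : Fin (suc (n + k)) → Carrierᴹ) →
                   act (comp (proj₁ p) i (proj₁ q) , r) as ≈ᴹ
                   act p (plug as (toℕ i) (suc k)
                            (act q (slice (suc k) as (toℕ i))))

  args₂ : Carrierᴹ → Carrierᴹ → (Fin 2 → Carrierᴹ)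
  args₂ b₁ b₂ Fin.zero       = b₁
  args₂ b₁ b₂ (Fin.suc _)    = b₂

{-# OPTIONS --safe #-}
-- A noncrossing clique acts by evaluating its arcs from the inside out: an
-- edge carries its argument, a longer arc (x, y) the ⊙-product of the values
-- of the arcs directly below it (the maximal solid diagonals nested in (x, y)
-- and the edges they leave uncovered), and then every arc applies ω with its
-- own label. As ⊙ is associative and ω_𝟙 is the identity, that product may
-- be split at any vertex that no solid arc nested in (x, y) jumps over. So
-- evaluation is local, multilinear (each ω_x and ⊙ being so), and preserved by
-- strictly monotone embeddings of polygons. A partial composition p ∘ᵢ q is
-- two such embeddings, of q onto the vertices i, …, i + m and of p onto the
-- others, except at the glued arc, labelled p_i ⋆ q_0, which evaluates to
-- ω_{p_i}(ω_{q_0}(…)) by ω_x ∘ ω_y = ω_{x⋆y}, i.e. to the action of q seen as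
-- the argument of the i-th edge of p.
-- Finiteness of 𝓜 is used only to decide x ≡ 𝟙; no property of 𝕂 is used.
module Submission where

open import Defs
open import Level using (Level)
open import Algebra.Bundles using (CommutativeRing)
open import Data.Bool using (Bool; true; false; if_then_else_; T; _∧_; _∨_)
open import Data.Bool.Properties using (T-∧; T-∨)
open import Data.Empty using (⊥; ⊥-elim)
open import Data.Fin as Fin using (Fin; toℕ; fromℕ<)
open import Data.Fin.Properties using (inj⇒≟; toℕ-fromℕ<; fromℕ<-toℕ; toℕ<n)
open import Data.Nat
  using (ℕ; zero; suc; _+_; _∸_; _<_; _≤_; _≤?_; _<?_; _≤ᵇ_; _≡ᵇ_; _<ᵇ_; z≤n; s≤s; z<s; s≤s⁻¹)
open import Data.Nat.Properties
open import Data.Product as Product using (Σ; ∃; _×_; _,_; proj₁; proj₂)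
open import Data.Sum as Sum using (_⊎_; inj₁; inj₂)
open import Function.Bundles using (Equivalence)
open import Function using (_∘_)
open import Function.Properties.Inverse using (↔⇒↣)
open import Relation.Nullary using (¬_; Dec; yes; no)
open import Relation.Nullary.Decidable using (decidable-stable; _×-dec_)
open import Relation.Binary.Definitions using (tri<; tri≈; tri>)
open import Relation.Binary.PropositionalEquality
  using (_≡_; _≢_; refl; sym; trans; cong; cong₂; subst; subst₂)

finite⇒≟ : ∀ {m} (𝓜 : UnitaryMagma m) → Finite 𝓜 →
           (x y : UnitaryMagma.Carrier 𝓜) → Dec (x ≡ y)
finite⇒≟ 𝓜 (k , inv) = inj⇒≟ (↔⇒↣ inv)

if-T : ∀ {ℓ} {X : Set ℓ} {b : Bool} {x y : X} → T b → (if b then x else y) ≡ x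
if-T {b = true} _ = refl

if-¬T : ∀ {ℓ} {X : Set ℓ} {b : Bool} {x y : X} → ¬ T b → (if b then x else y) ≡ y
if-¬T {b = false} _ = refl
if-¬T {b = true}  ¬t = ⊥-elim (¬t _)

Nested : ℕ → ℕ → ℕ → ℕ → Set
Nested x y u w = x ≤ u × u < w × w ≤ y × (x < u ⊎ w < y)

Nested-trans : ∀ {x y x′ y′ u w} → Nested x y x′ y′ → Nested x′ y′ u w → Nested x y u w
Nested-trans {x} {y} {x′} {y′} {u} {w} (x≤x′ , _ , y′≤y , outer) (x′≤u , u<w , w≤y′ , _) =
  ≤-trans x≤x′ x′≤u , u<w , ≤-trans w≤y′ y′≤y , strict outer
  where
    strict : x < x′ ⊎ y′ < y → x < u ⊎ w < y
    strict (inj₁ x<x′) = inj₁ (<-≤-trans x<x′ x′≤u)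
    strict (inj₂ y′<y) = inj₂ (≤-<-trans w≤y′ y′<y)

Nested-shorter : ∀ {x y u w} → Nested x y u w → w ∸ u < y ∸ x
Nested-shorter {x} {y} {u} {w} (x≤u , u<w , w≤y , inj₁ x<u) =
  <-≤-trans (∸-monoʳ-< x<u (<⇒≤ u<w)) (∸-monoˡ-≤ x w≤y)
Nested-shorter {x} {y} {u} {w} (x≤u , u<w , w≤y , inj₂ w<y) =
  ≤-<-trans (∸-monoʳ-≤ w x≤u) (∸-monoˡ-< w<y (≤-trans x≤u (<⇒≤ u<w)))

Nested-widen : ∀ {x y x′ y′ u w} → x′ ≤ x → y ≤ y′ → Nested x y u w → Nested x′ y′ u w
Nested-widen x′≤x y≤y′ (x≤u , u<w , w≤y , inj₁ x<u) =
  ≤-trans x′≤x x≤u , u<w , ≤-trans w≤y y≤y′ , inj₁ (≤-<-trans x′≤x x<u)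
Nested-widen x′≤x y≤y′ (x≤u , u<w , w≤y , inj₂ w<y) =
  ≤-trans x′≤x x≤u , u<w , ≤-trans w≤y y≤y′ , inj₂ (<-≤-trans w<y y≤y′)

module StrictlyMonotone {s : ℕ → ℕ} (s-mono : ∀ {a b} → a < b → s a < s b) where
  s-mono-≤ : ∀ {a b} → a ≤ b → s a ≤ s b
  s-mono-≤ a≤b with m≤n⇒m<n∨m≡n a≤b
  ... | inj₁ a<b  = <⇒≤ (s-mono a<b)
  ... | inj₂ refl = ≤-refl

  s-reflects-≤ : ∀ {a b} → s a ≤ s b → a ≤ b
  s-reflects-≤ sa≤sb = ≮⇒≥ λ b<a → <⇒≱ (s-mono b<a) sa≤sb

  s-injective : ∀ {a b} → s a ≡ s b → a ≡ b
  s-injective sa≡sb = ≤-antisym (s-reflects-≤ (≤-reflexive sa≡sb)) (s-reflects-≤ (≤-reflexive (sym sa≡sb)))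

  s-reflects-< : ∀ {a b} → s a < s b → a < b
  s-reflects-< sa<sb = ≰⇒> λ b≤a → <⇒≱ sa<sb (s-mono-≤ b≤a)

  Nested-reflect : ∀ {a b u w} → Nested (s a) (s b) (s u) (s w) → Nested a b u w
  Nested-reflect (a≤u , u<w , w≤b , strict) =
    s-reflects-≤ a≤u , s-reflects-< u<w , s-reflects-≤ w≤b , Sum.map s-reflects-< s-reflects-< strict

arc-induction : ∀ {p} (P : ℕ → ℕ → Set p) →
                (∀ x y → x < y → (∀ u w → Nested x y u w → P u w) → P x y) →
                ∀ x y → x < y → P x y
arc-induction P step x y = go (suc (y ∸ x)) x y ≤-refl
  where
    go : ∀ d x y → y ∸ x < d → x < y → P x y
    go (suc d) x y len<d x<y = step x y x<y λ u w nested →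
      go d u w (<-≤-trans (Nested-shorter nested) (s≤s⁻¹ len<d)) (proj₁ (proj₂ nested))

-- Noncrossing labellings

module Labellings {m : Level} (𝓜 : UnitaryMagma m)
                  (_≟𝟙 : ∀ z → Dec (z ≡ UnitaryMagma.𝟙 𝓜)) where
  open UnitaryMagma 𝓜 renaming (Carrier to M)
  open Cliques 𝓜 using (Solid)

  Labelling : Set m
  Labelling = ℕ → ℕ → M

  NonCrossingUpTo : Labelling → ℕ → Set m
  NonCrossingUpTo L n = ∀ x y x′ y′ → x < x′ → x′ < y → y < y′ → y′ ≤ n →
                        ¬ (Solid (L x y) × Solid (L x′ y′))

  -- z is a vertex of the region directly below the arc (x, y), i.e. of the
  -- polygon left over when the solid arcs nested in (x, y) are cut off.
  SplitPoint : Labelling → ℕ → ℕ → ℕ → Set m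
  SplitPoint L x y z = ∀ u w → Nested x y u w → u < z → z < w → L u w ≡ 𝟙

  SplitPoint-nested : ∀ {L x y x′ y′ z} → Nested x y x′ y′ → SplitPoint L x y z → SplitPoint L x′ y′ z
  SplitPoint-nested outer split u w inner = split u w (Nested-trans outer inner)

  -- The largest w with suc x < w < y and L x w solid, or suc x if there is none:
  -- (x, lastSplit L x y) is the first part of the region below (x, y).
  lastSplit : Labelling → ℕ → ℕ → ℕ
  lastSplit L x zero = suc x
  lastSplit L x (suc w) with w ≤? suc x | L x w ≟𝟙
  ... | yes _ | _     = suc x
  ... | no _  | yes _ = lastSplit L x w
  ... | no _  | no _  = w

  module _ (L : Labelling) (x : ℕ) where
    lastSplit-> : ∀ y → x < lastSplit L x y
    lastSplit-> zero = n<1+n x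
    lastSplit-> (suc w) with w ≤? suc x | L x w ≟𝟙
    ... | yes _ | _     = n<1+n x
    ... | no _  | yes _ = lastSplit-> w
    ... | no w≰ | no _  = <-trans (n<1+n x) (≰⇒> w≰)

    lastSplit-< : ∀ y → suc x < y → lastSplit L x y < y
    lastSplit-< (suc w) x+1<y with w ≤? suc x | L x w ≟𝟙
    ... | yes _ | _     = x+1<y
    ... | no w≰ | yes _ = m<n⇒m<1+n (lastSplit-< w (≰⇒> w≰))
    ... | no _  | no _  = n<1+n w

    lastSplit-solid : ∀ y → lastSplit L x y ≡ suc x ⊎ Solid (L x (lastSplit L x y))
    lastSplit-solid zero = inj₁ refl
    lastSplit-solid (suc w) with w ≤? suc x | L x w ≟𝟙
    ... | yes _ | _       = inj₁ refl
    ... | no _  | yes _   = lastSplit-solid w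
    ... | no _  | no solid = inj₂ solid

    lastSplit-maximal : ∀ y w → lastSplit L x y < w → w < y → L x w ≡ 𝟙
    lastSplit-maximal (suc v) w z<w w<y with v ≤? suc x | L x v ≟𝟙
    ... | yes v≤ | _ = ⊥-elim (<-irrefl refl (<-≤-trans z<w (≤-trans (s≤s⁻¹ w<y) v≤)))
    ... | no _ | yes unlabelled with m≤n⇒m<n∨m≡n (s≤s⁻¹ w<y)
    ...   | inj₁ w<v = lastSplit-maximal v w z<w w<v
    ...   | inj₂ refl = unlabelled
    lastSplit-maximal (suc v) w z<w w<y | no _ | no _ =
      ⊥-elim (<-irrefl refl (<-≤-trans z<w (s≤s⁻¹ w<y)))

  module _ (L : Labelling) {x y : ℕ} (x+1<y : suc x < y) where
    lastSplit-left : Nested x y x (lastSplit L x y)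
    lastSplit-left = ≤-refl , lastSplit-> L x y , <⇒≤ (lastSplit-< L x y x+1<y) ,
                     inj₂ (lastSplit-< L x y x+1<y)

    lastSplit-right : Nested x y (lastSplit L x y) y
    lastSplit-right = <⇒≤ (lastSplit-> L x y) , lastSplit-< L x y x+1<y , ≤-refl ,
                      inj₁ (lastSplit-> L x y)

    lastSplit-splitPoint : ∀ {n} → NonCrossingUpTo L n → y ≤ n → SplitPoint L x y (lastSplit L x y)
    lastSplit-splitPoint nc y≤n u w (x≤u , _ , w≤y , nested) u<z z<w
      with m≤n⇒m<n∨m≡n x≤u
    ... | inj₂ refl = lastSplit-maximal L x y w z<w (w<y nested)
      where
        w<y : x < x ⊎ w < y → w < y
        w<y (inj₁ x<x) = ⊥-elim (<-irrefl refl x<x)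
        w<y (inj₂ w<y) = w<y
    ... | inj₁ x<u with lastSplit-solid L x y
    ...   | inj₁ z≡x+1 = ⊥-elim (<-irrefl refl (<-≤-trans x<u (s≤s⁻¹ (subst (u <_) z≡x+1 u<z))))
    ...   | inj₂ solid = decidable-stable (L u w ≟𝟙) λ solid′ →
              nc x (lastSplit L x y) u w x<u u<z z<w (≤-trans w≤y y≤n) (solid , solid′)

module _ {c ℓ a ℓa} {K : CommutativeRing c ℓ} (A : AssocAlgebra K a ℓa) where
  open AssocAlgebra A
  open IsLinear renaming (cong to lin-cong)
  open import Relation.Binary.Reasoning.Setoid ≈ᴹ-setoid

  isLinear-id : IsLinear A (λ b → b)
  isLinear-id = record { cong = λ b≈b′ → b≈b′ ; additive = λ _ _ → ≈ᴹ-refl ; homog = λ _ _ → ≈ᴹ-refl }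

  isLinear-∘ : ∀ {g h} → IsLinear A g → IsLinear A h → IsLinear A (λ b → g (h b))
  isLinear-∘ {g} {h} g-lin h-lin = record
    { cong     = λ b≈b′ → lin-cong g-lin (lin-cong h-lin b≈b′)
    ; additive = λ b b′ → ≈ᴹ-trans (lin-cong g-lin (additive h-lin b b′)) (additive g-lin _ _)
    ; homog    = λ λ′ b → ≈ᴹ-trans (lin-cong g-lin (homog h-lin λ′ b)) (homog g-lin _ _)
    }

  isLinear-⊙ʳ : ∀ {g} → IsLinear A g → ∀ e → IsLinear A (λ b → g b ⊙ e)
  isLinear-⊙ʳ {g} g-lin e = record
    { cong     = λ b≈b′ → ⊙-cong (lin-cong g-lin b≈b′) ≈ᴹ-refl
    ; additive = λ b b′ → ≈ᴹ-trans (⊙-cong (additive g-lin b b′) ≈ᴹ-refl) (⊙-distribʳ _ _ _)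
    ; homog    = λ λ′ b → ≈ᴹ-trans (⊙-cong (homog g-lin λ′ b) ≈ᴹ-refl) (⊙-scalarˡ _ _ _)
    }

  isLinear-⊙ˡ : ∀ {g} e → IsLinear A g → IsLinear A (λ b → e ⊙ g b)
  isLinear-⊙ˡ {g} e g-lin = record
    { cong     = λ b≈b′ → ⊙-cong ≈ᴹ-refl (lin-cong g-lin b≈b′)
    ; additive = λ b b′ → ≈ᴹ-trans (⊙-cong ≈ᴹ-refl (additive g-lin b b′)) (⊙-distribˡ _ _ _)
    ; homog    = λ λ′ b → ≈ᴹ-trans (⊙-cong ≈ᴹ-refl (homog g-lin λ′ b)) (⊙-scalarʳ _ _ _)
    }

  isLinear-resp : ∀ {g h} → IsLinear A g → (∀ b → g b ≈ᴹ h b) → IsLinear A h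
  isLinear-resp {g} {h} g-lin g≈h = record
    { cong     = λ {b} {b′} b≈b′ → begin
        h b             ≈⟨ g≈h b ⟨
        g b             ≈⟨ lin-cong g-lin b≈b′ ⟩
        g b′            ≈⟨ g≈h b′ ⟩
        h b′            ∎
    ; additive = λ b b′ → begin
        h (b +ᴹ b′)     ≈⟨ g≈h _ ⟨
        g (b +ᴹ b′)     ≈⟨ additive g-lin b b′ ⟩
        g b +ᴹ g b′     ≈⟨ +ᴹ-cong (g≈h b) (g≈h b′) ⟩
        h b +ᴹ h b′     ∎
    ; homog    = λ λ′ b → begin
        h (λ′ *ₗ b)     ≈⟨ g≈h _ ⟨
        g (λ′ *ₗ b)     ≈⟨ homog g-lin λ′ b ⟩
        λ′ *ₗ g b       ≈⟨ *ₗ-congˡ (g≈h b) ⟩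
        λ′ *ₗ h b       ∎
    }

-- Evaluating noncrossing cliques

module Evaluation
  {c ℓ a ℓa m : Level} {K : CommutativeRing c ℓ}
  (𝓜 : UnitaryMagma m) (_≟𝟙 : ∀ z → Dec (z ≡ UnitaryMagma.𝟙 𝓜))
  (A : AssocAlgebra K a ℓa)
  (ω : UnitaryMagma.Carrier 𝓜 → AssocAlgebra.Carrierᴹ A → AssocAlgebra.Carrierᴹ A)
  (ω-linear : ∀ x → IsLinear A (ω x))
  (ω-𝟙 : ∀ b → AssocAlgebra._≈ᴹ_ A (ω (UnitaryMagma.𝟙 𝓜) b) b)
  where

  open AssocAlgebra A
  open UnitaryMagma 𝓜 renaming (Carrier to M)
  open Labellings 𝓜 _≟𝟙
  open import Relation.Binary.Reasoning.Setoid ≈ᴹ-setoid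

  Arguments : Set a
  Arguments = ℕ → Carrierᴹ

  ω-cong : ∀ x {b b′} → b ≈ᴹ b′ → ω x b ≈ᴹ ω x b′
  ω-cong x = IsLinear.cong (ω-linear x)

  -- The fuel only bounds the recursion depth: it is enough that it exceed
  -- y ∸ x, as both parts of a split are shorter arcs.
  mutual
    valueWith : ℕ → Labelling → Arguments → ℕ → ℕ → Carrierᴹ
    valueWith zero    L f x y = 0ᴹ
    valueWith (suc F) L f x y = ω (L x y) (productWith F L f x y)

    productWith : ℕ → Labelling → Arguments → ℕ → ℕ → Carrierᴹ
    productWith F L f x y with y ≤? suc x
    ... | yes _ = f x
    ... | no _  = valueWith F L f x z ⊙ valueWith F L f z y
      where z = lastSplit L x y

  value : Labelling → Arguments → ℕ → ℕ → Carrierᴹ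
  value L f x y = valueWith (suc (y ∸ x)) L f x y

  product : Labelling → Arguments → ℕ → ℕ → Carrierᴹ
  product L f x y = productWith (y ∸ x) L f x y

  module _ (L : Labelling) (f : Arguments) where
    mutual
      valueWith-fuel : ∀ F G x y → y ∸ x < F → y ∸ x < G →
                       valueWith F L f x y ≡ valueWith G L f x y
      valueWith-fuel (suc F) (suc G) x y (s≤s len≤F) (s≤s len≤G) =
        cong (ω (L x y)) (productWith-fuel F G x y len≤F len≤G)

      productWith-fuel : ∀ F G x y → y ∸ x ≤ F → y ∸ x ≤ G →
                         productWith F L f x y ≡ productWith G L f x y
      productWith-fuel F G x y len≤F len≤G with y ≤? suc x
      ... | yes _ = refl
      ... | no y≰x+1 = cong₂ _⊙_ (part (lastSplit-left L x+1<y)) (part (lastSplit-right L x+1<y))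
        where
          x+1<y : suc x < y
          x+1<y = ≰⇒> y≰x+1
          part : ∀ {u w} → Nested x y u w → valueWith F L f u w ≡ valueWith G L f u w
          part nested = valueWith-fuel F G _ _ (<-≤-trans (Nested-shorter nested) len≤F)
                                                  (<-≤-trans (Nested-shorter nested) len≤G)

    product-edge : ∀ x → product L f x (suc x) ≡ f x
    product-edge x with suc x ≤? suc x
    ... | yes _ = refl
    ... | no x+1≰x+1 = ⊥-elim (x+1≰x+1 ≤-refl)

    product-split : ∀ x y → suc x < y →
                    product L f x y ≡ value L f x (lastSplit L x y) ⊙ value L f (lastSplit L x y) y
    product-split x y x+1<y with y ≤? suc x
    ... | yes y≤x+1 = ⊥-elim (<-irrefl refl (<-≤-trans x+1<y y≤x+1))
    ... | no _ = cong₂ _⊙_ (part (lastSplit-left L x+1<y)) (part (lastSplit-right L x+1<y))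
      where
        part : ∀ {u w} → Nested x y u w → valueWith (y ∸ x) L f u w ≡ value L f u w
        part nested = valueWith-fuel (y ∸ x) _ _ _ (Nested-shorter nested) ≤-refl

    value-𝟙 : ∀ {x y} → L x y ≡ 𝟙 → value L f x y ≈ᴹ product L f x y
    value-𝟙 {x} {y} unlabelled =
      ≈ᴹ-trans (≈ᴹ-reflexive (cong (λ ℓ → ω ℓ (product L f x y)) unlabelled)) (ω-𝟙 _)

  module _ (L : Labelling) where
    value-resp-product : ∀ {x y} {f g : Arguments} → product L f x y ≈ᴹ product L g x y →
                    value L f x y ≈ᴹ value L g x y
    value-resp-product {x} {y} = ω-cong (L x y)

    product-local : ∀ (f g : Arguments) x y → x < y → (∀ t → x ≤ t → t < y → f t ≈ᴹ g t) →
                    product L f x y ≈ᴹ product L g x y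
    product-local f g = arc-induction _ step
      where
        step : ∀ x y → x < y →
               (∀ u w → Nested x y u w → (∀ t → u ≤ t → t < w → f t ≈ᴹ g t) →
                  product L f u w ≈ᴹ product L g u w) →
               (∀ t → x ≤ t → t < y → f t ≈ᴹ g t) → product L f x y ≈ᴹ product L g x y
        step x y x<y ih f≈g with m≤n⇒m<n∨m≡n x<y
        ... | inj₂ refl = begin
          product L f x (suc x) ≡⟨ product-edge L f x ⟩
          f x                   ≈⟨ f≈g x ≤-refl ≤-refl ⟩
          g x                   ≡⟨ product-edge L g x ⟨
          product L g x (suc x) ∎
        ... | inj₁ x+1<y = begin
          product L f x y               ≡⟨ product-split L f x y x+1<y ⟩
          value L f x z ⊙ value L f z y ≈⟨ ⊙-cong (part (lastSplit-left L x+1<y))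
                                                  (part (lastSplit-right L x+1<y)) ⟩
          value L g x z ⊙ value L g z y ≡⟨ product-split L g x y x+1<y ⟨
          product L g x y               ∎
          where
            z = lastSplit L x y
            part : ∀ {u w} → Nested x y u w → value L f u w ≈ᴹ value L g u w
            part nested@(x≤u , _ , w≤y , _) = value-resp-product (ih _ _ nested λ t u≤t t<w →
              f≈g t (≤-trans x≤u u≤t) (<-≤-trans t<w w≤y))

    value-local : ∀ (f g : Arguments) x y → x < y → (∀ t → x ≤ t → t < y → f t ≈ᴹ g t) →
                  value L f x y ≈ᴹ value L g x y
    value-local f g x y x<y f≈g = value-resp-product (product-local f g x y x<y f≈g)

    module _ (f : Arguments) {n} (nc : NonCrossingUpTo L n) where
      product-reassoc : ∀ x y z → y ≤ n → x < z → z < y → SplitPoint L x y z →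
                        product L f x y ≈ᴹ value L f x z ⊙ value L f z y
      product-reassoc x y z y≤n x<z z<y = arc-induction _ step x y (<-trans x<z z<y) z y≤n x<z z<y
        where
          Reassoc : ℕ → ℕ → Set _
          Reassoc x y = ∀ z → y ≤ n → x < z → z < y → SplitPoint L x y z →
                        product L f x y ≈ᴹ value L f x z ⊙ value L f z y
          step : ∀ x y → x < y → (∀ u w → Nested x y u w → Reassoc u w) → Reassoc x y
          step x y _ ih z y≤n x<z z<y split with <-cmp z (lastSplit L x y)
          ... | tri≈ _ refl _ = ≈ᴹ-reflexive (product-split L f x y (≤-<-trans x<z z<y))
          ... | tri< z<z₀ _ _ with lastSplit-solid L x y
          ...   | inj₁ z₀≡x+1 = ⊥-elim (<-irrefl refl (<-≤-trans x<z (s≤s⁻¹ (subst (z <_) z₀≡x+1 z<z₀))))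
          ...   | inj₂ solid  = ⊥-elim (solid (split x _ (lastSplit-left L (≤-<-trans x<z z<y)) x<z z<z₀))
          step x y _ ih z y≤n x<z z<y split | tri> _ _ z₀<z = begin
            product L f x y                               ≡⟨ product-split L f x y x+1<y ⟩
            value L f x z₀ ⊙ value L f z₀ y               ≈⟨ ⊙-cong ≈ᴹ-refl right ⟩
            value L f x z₀ ⊙ (value L f z₀ z ⊙ value L f z y) ≈⟨ ⊙-assoc _ _ _ ⟨
            (value L f x z₀ ⊙ value L f z₀ z) ⊙ value L f z y ≈⟨ ⊙-cong left ≈ᴹ-refl ⟩
            value L f x z ⊙ value L f z y                 ∎
            where
              x+1<y : suc x < y
              x+1<y = ≤-<-trans x<z z<y
              z₀ : ℕ
              z₀ = lastSplit L x y
              z₀-y : Nested x y z₀ y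
              z₀-y = lastSplit-right L x+1<y
              x-z : Nested x y x z
              x-z = ≤-refl , x<z , <⇒≤ z<y , inj₂ z<y
              right : value L f z₀ y ≈ᴹ value L f z₀ z ⊙ value L f z y
              right = ≈ᴹ-trans (value-𝟙 L f (split z₀ y z₀-y z₀<z z<y))
                               (ih z₀ y z₀-y z y≤n z₀<z z<y (SplitPoint-nested z₀-y split))
              left : value L f x z₀ ⊙ value L f z₀ z ≈ᴹ value L f x z
              left = ≈ᴹ-sym (≈ᴹ-trans (value-𝟙 L f (lastSplit-maximal L x y z z₀<z z<y))
                       (ih x z x-z z₀ (≤-trans (<⇒≤ z<y) y≤n) (lastSplit-> L x y) z₀<z
                           (SplitPoint-nested x-z (lastSplit-splitPoint L x+1<y nc y≤n))))

    module _ (g : Arguments) (j : ℕ) (F : Carrierᴹ → Arguments)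
             (F-slot : ∀ b → F b j ≈ᴹ b) (F-elsewhere : ∀ b t → t ≢ j → F b t ≈ᴹ g t) where
      value-off-slot : ∀ b {u w} → u < w → (∀ t → u ≤ t → t < w → t ≢ j) →
                       value L (F b) u w ≈ᴹ value L g u w
      value-off-slot b u<w off =
        value-local (F b) g _ _ u<w λ t u≤t t<w → F-elsewhere b t (off t u≤t t<w)

      product-linear : ∀ x y → x < y → x ≤ j → j < y → IsLinear A (λ b → product L (F b) x y)
      product-linear = arc-induction _ step
        where
          Linear : ℕ → ℕ → Set _
          Linear x y = x ≤ j → j < y → IsLinear A (λ b → product L (F b) x y)

          step : ∀ x y → x < y → (∀ u w → Nested x y u w → Linear u w) → Linear x y
          step x y x<y ih x≤j j<y with m≤n⇒m<n∨m≡n x<y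
          ... | inj₂ refl with ≤-antisym (s≤s⁻¹ j<y) x≤j
          ...   | refl = isLinear-resp A (isLinear-id A) λ b →
                    ≈ᴹ-trans (≈ᴹ-sym (F-slot b)) (≈ᴹ-reflexive (sym (product-edge L (F b) j)))
          step x y x<y ih x≤j j<y | inj₁ x+1<y with j <? lastSplit L x y
          ... | yes j<z = isLinear-resp A (isLinear-⊙ʳ A left-linear (value L g z y)) λ b → begin
              value L (F b) x z ⊙ value L g z y
                ≈⟨ ⊙-cong ≈ᴹ-refl (value-off-slot b z<y λ { _ z≤t _ refl → <⇒≱ j<z z≤t }) ⟨
              value L (F b) x z ⊙ value L (F b) z y
                ≡⟨ product-split L (F b) x y x+1<y ⟨
              product L (F b) x y
                ∎
            where
              z : ℕ
              z = lastSplit L x y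
              z<y : z < y
              z<y = lastSplit-< L x y x+1<y
              left-linear : IsLinear A (λ b → value L (F b) x z)
              left-linear = isLinear-∘ A (ω-linear _) (ih x z (lastSplit-left L x+1<y) x≤j j<z)
          ... | no j≮z = isLinear-resp A (isLinear-⊙ˡ A (value L g x z) right-linear) λ b → begin
              value L g x z ⊙ value L (F b) z y
                ≈⟨ ⊙-cong (value-off-slot b (lastSplit-> L x y) λ { _ _ t<z refl → j≮z t<z }) ≈ᴹ-refl ⟨
              value L (F b) x z ⊙ value L (F b) z y
                ≡⟨ product-split L (F b) x y x+1<y ⟨
              product L (F b) x y
                ∎
            where
              z : ℕ
              z = lastSplit L x y
              right-linear : IsLinear A (λ b → value L (F b) z y)
              right-linear = isLinear-∘ A (ω-linear _) (ih z y (lastSplit-right L x+1<y) (≮⇒≥ j≮z) j<y)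

      value-linear : ∀ x y → x ≤ j → j < y → IsLinear A (λ b → value L (F b) x y)
      value-linear x y x≤j j<y =
        isLinear-∘ A (ω-linear (L x y)) (product-linear x y (≤-<-trans x≤j j<y) x≤j j<y)

  -- A strictly monotone map s of vertices from a source polygon into a target
  -- one preserves evaluation if it maps edges to edges and labels to equal
  -- labels, except on exceptional edges whose values are compared directly,
  -- and if every target arc jumping over an image vertex is either unlabelled
  -- or joins two image vertices.
  module Embedding
    (s : ℕ → ℕ) (s-mono : ∀ {a b} → a < b → s a < s b)
    (Lˢ Lᵗ : Labelling) (fˢ fᵗ : Arguments) {N Nᵗ : ℕ}
    (ncˢ : NonCrossingUpTo Lˢ N) (ncᵗ : NonCrossingUpTo Lᵗ Nᵗ) (sN≤Nᵗ : s N ≤ Nᵗ)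
    (Exceptional : ℕ → Set) (exceptional? : ∀ a → Dec (Exceptional a))
    (edge-ordinary : ∀ a → suc a ≤ N → ¬ Exceptional a →
                     s (suc a) ≡ suc (s a) × fᵗ (s a) ≈ᴹ fˢ a)
    (edge-exceptional : ∀ a → suc a ≤ N → Exceptional a →
                        value Lᵗ fᵗ (s a) (s (suc a)) ≈ᴹ value Lˢ fˢ a (suc a))
    (label : ∀ a b → Nested 0 N a b → ¬ (Exceptional a × b ≡ suc a) → Lᵗ (s a) (s b) ≡ Lˢ a b)
    (covered : ∀ u w v → s 0 ≤ u → u < s v → s v < w → w ≤ s N →
               Lᵗ u w ≡ 𝟙 ⊎ (∃ λ u′ → s u′ ≡ u) × (∃ λ w′ → s w′ ≡ w))
    where
    open StrictlyMonotone s-mono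

    ExceptionalArc : ℕ → ℕ → Set
    ExceptionalArc a b = Exceptional a × b ≡ suc a

    value-from-product : ∀ {a b} → b ≤ N →
      (¬ ExceptionalArc a b → Lᵗ (s a) (s b) ≡ Lˢ a b) →
      (¬ ExceptionalArc a b → product Lᵗ fᵗ (s a) (s b) ≈ᴹ product Lˢ fˢ a b) →
      value Lᵗ fᵗ (s a) (s b) ≈ᴹ value Lˢ fˢ a b
    value-from-product {a} {b} b≤N same-label same-product with exceptional? a ×-dec (b ≟ suc a)
    ... | yes (exc , refl) = edge-exceptional a b≤N exc
    ... | no ordinary = begin
      ω (Lᵗ (s a) (s b)) (product Lᵗ fᵗ (s a) (s b)) ≡⟨ cong (λ ℓ → ω ℓ _) (same-label ordinary) ⟩
      ω (Lˢ a b) (product Lᵗ fᵗ (s a) (s b))         ≈⟨ ω-cong _ (same-product ordinary) ⟩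
      ω (Lˢ a b) (product Lˢ fˢ a b)                 ∎

    splitPoint-image : ∀ {a b} → b ≤ N → suc a < b →
                       SplitPoint Lᵗ (s a) (s b) (s (lastSplit Lˢ a b))
    splitPoint-image {a} {b} b≤N a+1<b u w nested@(sa≤u , _ , w≤sb , _) u<sz sz<w
      with covered u w (lastSplit Lˢ a b) (≤-trans (s-mono-≤ z≤n) sa≤u) u<sz sz<w
                   (≤-trans w≤sb (s-mono-≤ b≤N))
    ... | inj₁ unlabelled = unlabelled
    ... | inj₂ ((u′ , refl) , (w′ , refl)) =
      trans (label u′ w′ (Nested-widen z≤n b≤N nested′) ordinary)
            (lastSplit-splitPoint Lˢ a+1<b ncˢ b≤N u′ w′ nested′ u′<z z<w′)
      where
        z : ℕ
        z = lastSplit Lˢ a b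
        nested′ : Nested a b u′ w′
        nested′ = Nested-reflect nested
        u′<z : u′ < z
        u′<z = s-reflects-< u<sz
        z<w′ : z < w′
        z<w′ = s-reflects-< sz<w
        ordinary : ¬ ExceptionalArc u′ w′
        ordinary (_ , refl) = <-irrefl refl (<-≤-trans z<w′ u′<z)

    product-embeds : ∀ a b → a < b → b ≤ N → ¬ ExceptionalArc a b →
                     product Lᵗ fᵗ (s a) (s b) ≈ᴹ product Lˢ fˢ a b
    product-embeds = arc-induction _ step
      where
        Embeds : ℕ → ℕ → Set _
        Embeds a b = b ≤ N → ¬ ExceptionalArc a b → product Lᵗ fᵗ (s a) (s b) ≈ᴹ product Lˢ fˢ a b

        step : ∀ a b → a < b → (∀ u w → Nested a b u w → Embeds u w) → Embeds a b
        step a b a<b ih b≤N ordinary with m≤n⇒m<n∨m≡n a<b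
        ... | inj₂ refl = begin
          product Lᵗ fᵗ (s a) (s (suc a)) ≡⟨ cong (product Lᵗ fᵗ (s a)) (proj₁ ordinary-edge) ⟩
          product Lᵗ fᵗ (s a) (suc (s a)) ≡⟨ product-edge Lᵗ fᵗ (s a) ⟩
          fᵗ (s a)                        ≈⟨ proj₂ ordinary-edge ⟩
          fˢ a                            ≡⟨ product-edge Lˢ fˢ a ⟨
          product Lˢ fˢ a (suc a)         ∎
          where
            ordinary-edge : s (suc a) ≡ suc (s a) × fᵗ (s a) ≈ᴹ fˢ a
            ordinary-edge = edge-ordinary a b≤N λ exc → ordinary (exc , refl)
        ... | inj₁ a+1<b = begin
          product Lᵗ fᵗ (s a) (s b)
            ≈⟨ product-reassoc Lᵗ fᵗ ncᵗ (s a) (s b) (s z) (≤-trans (s-mono-≤ b≤N) sN≤Nᵗ)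
                               (s-mono a<z) (s-mono z<b) (splitPoint-image b≤N a+1<b) ⟩
          value Lᵗ fᵗ (s a) (s z) ⊙ value Lᵗ fᵗ (s z) (s b)
            ≈⟨ ⊙-cong (part (lastSplit-left Lˢ a+1<b)) (part (lastSplit-right Lˢ a+1<b)) ⟩
          value Lˢ fˢ a z ⊙ value Lˢ fˢ z b
            ≡⟨ product-split Lˢ fˢ a b a+1<b ⟨
          product Lˢ fˢ a b
            ∎
          where
            z : ℕ
            z = lastSplit Lˢ a b
            a<z : a < z
            a<z = lastSplit-> Lˢ a b
            z<b : z < b
            z<b = lastSplit-< Lˢ a b a+1<b
            part : ∀ {u w} → Nested a b u w → value Lᵗ fᵗ (s u) (s w) ≈ᴹ value Lˢ fˢ u w
            part {u} {w} nested@(_ , _ , w≤b , _) =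
              value-from-product (≤-trans w≤b b≤N) (label u w (Nested-widen z≤n b≤N nested))
                                 (ih u w nested (≤-trans w≤b b≤N))

    value-embeds : ∀ a b → a < b → b ≤ N → (¬ ExceptionalArc a b → Lᵗ (s a) (s b) ≡ Lˢ a b) →
                   value Lᵗ fᵗ (s a) (s b) ≈ᴹ value Lˢ fˢ a b
    value-embeds a b a<b b≤N same-label =
      value-from-product b≤N same-label (product-embeds a b a<b b≤N)

-- Partial composition

-- Vertex v of the outer clique of p ∘ q becomes vertex shift i k v of the
-- composite, where q (of arity suc k) is glued onto the edge (i, suc i).
module Shift (i k : ℕ) where
  shift : ℕ → ℕ
  shift v = if v ≤ᵇ i then v else v + k

  shift-≤ : ∀ {v} → v ≤ i → shift v ≡ v
  shift-≤ v≤i = if-T (≤⇒≤ᵇ v≤i)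

  shift-> : ∀ {v} → i < v → shift v ≡ v + k
  shift-> {v} i<v = if-¬T λ v≤ᵇi → <⇒≱ i<v (≤ᵇ⇒≤ v i v≤ᵇi)

  shift-mono : ∀ {a b} → a < b → shift a < shift b
  shift-mono {a} {b} a<b with a ≤? i | b ≤? i
  ... | yes a≤i | yes b≤i = subst₂ _<_ (sym (shift-≤ a≤i)) (sym (shift-≤ b≤i)) a<b
  ... | yes a≤i | no b≰i  =
    subst₂ _<_ (sym (shift-≤ a≤i)) (sym (shift-> (≰⇒> b≰i))) (<-≤-trans a<b (m≤m+n b k))
  ... | no a≰i  | yes b≤i = ⊥-elim (a≰i (≤-trans (<⇒≤ a<b) b≤i))
  ... | no a≰i  | no b≰i  =
    subst₂ _<_ (sym (shift-> (≰⇒> a≰i))) (sym (shift-> (≰⇒> b≰i))) (+-monoˡ-< k a<b)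

  shift-i+1 : shift (suc i) ≡ i + suc k
  shift-i+1 = trans (shift-> (n<1+n i)) (sym (+-suc i k))

  shift-suc : ∀ {a} → a ≢ i → shift (suc a) ≡ suc (shift a)
  shift-suc {a} a≢i with a ≤? i
  ... | yes a≤i = trans (shift-≤ (≤∧≢⇒< a≤i a≢i)) (cong suc (sym (shift-≤ a≤i)))
  ... | no a≰i  = trans (shift-> (m<n⇒m<1+n (≰⇒> a≰i))) (cong suc (sym (shift-> (≰⇒> a≰i))))

  shift-avoids : ∀ v → shift v ≤ i ⊎ i + suc k ≤ shift v
  shift-avoids v with v ≤? i
  ... | yes v≤i = inj₁ (subst (_≤ i) (sym (shift-≤ v≤i)) v≤i)
  ... | no v≰i  = inj₂ (subst (i + suc k ≤_) (sym (shift-> (≰⇒> v≰i)))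
                         (subst (_≤ v + k) (sym (+-suc i k)) (+-monoˡ-≤ k (≰⇒> v≰i))))

  shift-onto : ∀ u → u ≤ i ⊎ i + suc k ≤ u → ∃ λ v → shift v ≡ u
  shift-onto u (inj₁ u≤i) = u , shift-≤ u≤i
  shift-onto u (inj₂ i+k+1≤u) = u ∸ k , trans (shift-> i<u∸k) (m∸n+n≡m k≤u)
    where
      k≤u : k ≤ u
      k≤u = ≤-trans (m≤n+m k (suc i)) (subst (_≤ u) (+-suc i k) i+k+1≤u)
      i<u∸k : i < u ∸ k
      i<u∸k = +-cancelʳ-< k i (u ∸ k)
                (subst (i + k <_) (sym (m∸n+n≡m k≤u)) (subst (_≤ u) (+-suc i k) i+k+1≤u))

  -- The left-hand side is compLab's local unshift (for q of arity suc k).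
  unshift-shift : ∀ v → (if shift v ≤ᵇ i then shift v else shift v ∸ k) ≡ v
  unshift-shift v with v ≤? i
  ... | yes v≤i rewrite shift-≤ v≤i = if-T (≤⇒≤ᵇ v≤i)
  ... | no v≰i  rewrite shift-> (≰⇒> v≰i) =
    trans (if-¬T λ t → v≰i (≤-trans (m≤m+n v k) (≤ᵇ⇒≤ _ _ t))) (m+n∸n≡m v k)

module CompositionLabels {m} (𝓜 : UnitaryMagma m) {n k : ℕ}
  (P : Cliques.Clique 𝓜 (suc n)) (i : ℕ) (Q : Cliques.Clique 𝓜 (suc k)) where
  open UnitaryMagma 𝓜 using (𝟙; _⋆_)
  open Cliques 𝓜
  open Shift i k
  open StrictlyMonotone shift-mono

  StrictlyInside : ℕ → Set
  StrictlyInside v = i < v × v < i + suc k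

  private
    not-glued : ∀ {u w} → ¬ (u ≡ i × w ≡ i + suc k) → ¬ T ((u ≡ᵇ i) ∧ (w ≡ᵇ (i + suc k)))
    not-glued ne t = ne (Product.map (≡ᵇ⇒≡ _ _) (≡ᵇ⇒≡ _ _) (Equivalence.to T-∧ t))

    not-within : ∀ {u w} → ¬ (i ≤ u × w ≤ i + suc k) → ¬ T ((i ≤ᵇ u) ∧ (w ≤ᵇ (i + suc k)))
    not-within ne t = ne (Product.map (≤ᵇ⇒≤ _ _) (≤ᵇ⇒≤ _ _) (Equivalence.to T-∧ t))

    outside : ℕ → Bool
    outside v = (v ≤ᵇ i) ∨ ((i + suc k) ≤ᵇ v)

    inside-not-outside : ∀ {v} → StrictlyInside v → ¬ T (outside v)
    inside-not-outside (i<v , v<i+k+1) t with Equivalence.to T-∨ t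
    ... | inj₁ v≤ᵇi     = <⇒≱ i<v (≤ᵇ⇒≤ _ _ v≤ᵇi)
    ... | inj₂ i+k+1≤ᵇv = <⇒≱ v<i+k+1 (≤ᵇ⇒≤ _ _ i+k+1≤ᵇv)

  compLab-glued : compLab P i Q i (i + suc k) ≡ lab P i (suc i) ⋆ lab Q 0 (suc k)
  compLab-glued = if-T (Equivalence.from T-∧ (≡⇒≡ᵇ i i refl , ≡⇒≡ᵇ (i + suc k) _ refl))

  compLab-inner : ∀ {u w} → i ≤ u → w ≤ i + suc k → ¬ (u ≡ i × w ≡ i + suc k) →
                  compLab P i Q u w ≡ lab Q (u ∸ i) (w ∸ i)
  compLab-inner i≤u w≤i+k+1 ne =
    trans (if-¬T (not-glued ne)) (if-T (Equivalence.from T-∧ (≤⇒≤ᵇ i≤u , ≤⇒≤ᵇ w≤i+k+1)))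

  compLab-outer : ∀ {a b} → a < b → ¬ (a ≡ i × b ≡ suc i) →
                  compLab P i Q (shift a) (shift b) ≡ lab P a b
  compLab-outer {a} {b} a<b ne =
    trans (if-¬T (not-glued not-glued-arc))
    (trans (if-¬T (not-within not-within-arc))
    (trans (if-T {b = outside (shift a) ∧ outside (shift b)}
                 (Equivalence.from T-∧ (shift-outside a , shift-outside b)))
           (cong₂ (lab P) (unshift-shift a) (unshift-shift b))))
    where
      shift-outside : ∀ v → T (outside (shift v))
      shift-outside v = Equivalence.from T-∨ (Sum.map ≤⇒≤ᵇ ≤⇒≤ᵇ (shift-avoids v))

      not-glued-arc : ¬ (shift a ≡ i × shift b ≡ i + suc k)
      not-glued-arc (sa≡i , sb≡) = ne (s-injective (trans sa≡i (sym (shift-≤ ≤-refl))) ,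
                                        s-injective (trans sb≡ (sym shift-i+1)))

      not-within-arc : ¬ (i ≤ shift a × shift b ≤ i + suc k)
      not-within-arc (i≤sa , sb≤) with shift-avoids a
      ... | inj₂ i+k+1≤sa = <⇒≱ (shift-mono a<b) (≤-trans sb≤ i+k+1≤sa)
      ... | inj₁ sa≤i = ne (a≡i , ≤-antisym b≤i+1 i<b)
        where
          a≡i : a ≡ i
          a≡i = s-injective (trans (≤-antisym sa≤i i≤sa) (sym (shift-≤ ≤-refl)))
          b≤i+1 : b ≤ suc i
          b≤i+1 = s-reflects-≤ (subst (shift b ≤_) (sym shift-i+1) sb≤)
          i<b : i < b
          i<b = subst (_< b) a≡i a<b

  compLab-straddling : ∀ {u w} → ¬ (i ≤ u × w ≤ i + suc k) →
                       StrictlyInside u ⊎ StrictlyInside w → compLab P i Q u w ≡ 𝟙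
  compLab-straddling {u} {w} not-within-arc inside =
    trans (if-¬T (not-glued {u} {w} λ { (refl , refl) → not-within-arc (≤-refl , ≤-refl) }))
    (trans (if-¬T (not-within not-within-arc)) (if-¬T {b = outside u ∧ outside w} not-both-outside))
    where
      not-both-outside : ¬ T (outside u ∧ outside w)
      not-both-outside t with Equivalence.to T-∧ t
      ... | out-u , out-w = Sum.[ (λ in-u → inside-not-outside in-u out-u)
                                , (λ in-w → inside-not-outside in-w out-w) ] inside

-- The NC𝓜-algebra

module CliqueLabels {m} (𝓜 : UnitaryMagma m) where
  open UnitaryMagma 𝓜 renaming (Carrier to M)
  open Cliques 𝓜

  lab-mk : ∀ {n} (g : ℕ → ℕ → M) {x y} → x < y → y ≤ n → lab {n} (mk g) x y ≡ g x y
  lab-mk {n} g {x} {y} x<y y≤n with y <? suc n | x <? y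
  ... | yes y<n+1 | yes _   = cong₂ g (toℕ-fromℕ< _) (toℕ-fromℕ< y<n+1)
  ... | no y≮n+1  | _       = ⊥-elim (y≮n+1 (s≤s y≤n))
  ... | yes _     | no x≮y  = ⊥-elim (x≮y x<y)

  lab-ext : ∀ {n} (P Q : Clique n) → (∀ y x → P y x ≡ Q y x) → ∀ x y → lab P x y ≡ lab Q x y
  lab-ext {n} P Q P≡Q x y with y <? suc n | x <? y
  ... | yes _ | yes _ = P≡Q _ _
  ... | yes _ | no _  = refl
  ... | no _  | _     = refl

module ArgumentLists {c ℓ a ℓa m} {K : CommutativeRing c ℓ}
                     (𝓜 : UnitaryMagma m) (A : AssocAlgebra K a ℓa) where
  open AssocAlgebra A

  at′ : ∀ {N} → (Fin N → Carrierᴹ) → ℕ → Carrierᴹ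
  at′ = at 𝓜 A

  at′-fromℕ< : ∀ {N} (as : Fin N → Carrierᴹ) {t} (t<N : t < N) → at′ as t ≡ as (fromℕ< t<N)
  at′-fromℕ< {N} as {t} t<N with t <? N
  ... | yes _   = refl
  ... | no t≮N  = ⊥-elim (t≮N t<N)

  at′-cong : ∀ {N} (as bs : Fin N → Carrierᴹ) → (∀ t → as t ≈ᴹ bs t) → ∀ t → at′ as t ≈ᴹ at′ bs t
  at′-cong {N} as bs as≈bs t with t <? N
  ... | yes _ = as≈bs _
  ... | no _  = ≈ᴹ-refl

  module _ {N} (as : Fin N → Carrierᴹ) (j : Fin N) (b : Carrierᴹ) where
    private
      as′ : Fin N → Carrierᴹ
      as′ = _[_≔_] 𝓜 A as j b

    at′-update-≡ : at′ as′ (toℕ j) ≡ b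
    at′-update-≡ = trans (at′-fromℕ< as′ (toℕ<n j)) (trans (cong as′ (fromℕ<-toℕ j (toℕ<n j))) updated)
      where
        updated : as′ j ≡ b
        updated with j Fin.≟ j
        ... | yes _   = refl
        ... | no j≢j  = ⊥-elim (j≢j refl)

    at′-update-≢ : ∀ t → t ≢ toℕ j → at′ as′ t ≡ at′ as t
    at′-update-≢ t t≢j with t <? N
    ... | no _ = refl
    ... | yes t<N with fromℕ< t<N Fin.≟ j
    ...   | yes refl = ⊥-elim (t≢j (sym (toℕ-fromℕ< t<N)))
    ...   | no _     = refl

module Construction
  {c ℓ a ℓa m : Level} {K : CommutativeRing c ℓ}
  (𝓜 : UnitaryMagma m) (_≟𝟙 : ∀ z → Dec (z ≡ UnitaryMagma.𝟙 𝓜))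
  (A : AssocAlgebra K a ℓa)
  (ω : UnitaryMagma.Carrier 𝓜 → AssocAlgebra.Carrierᴹ A → AssocAlgebra.Carrierᴹ A)
  (ω-linear : ∀ x → IsLinear A (ω x))
  (ω-𝟙 : ∀ b → AssocAlgebra._≈ᴹ_ A (ω (UnitaryMagma.𝟙 𝓜) b) b)
  (ω-⋆ : ∀ x y b → AssocAlgebra._≈ᴹ_ A (ω x (ω y b)) (ω (UnitaryMagma._⋆_ 𝓜 x y) b))
  where

  open AssocAlgebra A
  open UnitaryMagma 𝓜 renaming (Carrier to M)
  open Cliques 𝓜
  open Labellings 𝓜 _≟𝟙
  open Evaluation 𝓜 _≟𝟙 A ω ω-linear ω-𝟙
  open CliqueLabels 𝓜
  open ArgumentLists 𝓜 A
  open import Relation.Binary.Reasoning.Setoid ≈ᴹ-setoid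

  act : Action 𝓜 A
  act {n} p as = value (lab (proj₁ p)) (at′ as) 0 (suc n)

  act-clique : ∀ {n} (p q : NCClique (suc n)) → (∀ y x → proj₁ p y x ≡ proj₁ q y x) →
               ∀ as → act p as ≈ᴹ act q as
  act-clique {n} (P , _ , ncP) (Q , _ , ncQ) P≡Q as =
    Same.value-embeds 0 (suc n) z<s ≤-refl λ _ → lab-ext P Q P≡Q 0 (suc n)
    where
      module Same = Embedding (λ v → v) (λ a<b → a<b) (lab Q) (lab P) (at′ as) (at′ as) ncQ ncP ≤-refl
        (λ _ → ⊥) (λ _ → no λ ()) (λ _ _ _ → refl , ≈ᴹ-refl) (λ _ _ ())
        (λ a b _ _ → lab-ext P Q P≡Q a b) (λ u w _ _ _ _ _ → inj₂ ((u , refl) , (w , refl)))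

  act-cong : ∀ {n} (p : NCClique (suc n)) as bs → (∀ t → as t ≈ᴹ bs t) → act p as ≈ᴹ act p bs
  act-cong {n} p as bs as≈bs =
    value-local (lab (proj₁ p)) (at′ as) (at′ bs) 0 (suc n) z<s λ t _ _ → at′-cong as bs as≈bs t

  act-linear : ∀ {n} (p : NCClique (suc n)) as j → IsLinear A (λ b → act p (_[_≔_] 𝓜 A as j b))
  act-linear {n} p as j =
    value-linear (lab (proj₁ p)) (at′ as) (toℕ j) (λ b → at′ (_[_≔_] 𝓜 A as j b))
      (λ b → ≈ᴹ-reflexive (at′-update-≡ as j b)) (λ b t t≢j → ≈ᴹ-reflexive (at′-update-≢ as j b t t≢j))
      0 (suc n) z≤n (toℕ<n j)

  module Composition {n k} (p : NCClique (suc n)) (i : Fin (suc n)) (q : NCClique (suc k))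
                     (r : NonCrossing (comp (proj₁ p) i (proj₁ q)))
                     (as : Fin (suc (n + k)) → Carrierᴹ) where
    I : ℕ
    I = toℕ i

    Lp Lq Lc : Labelling
    Lp = lab (proj₁ p)
    Lq = lab (proj₁ q)
    Lc = lab (comp (proj₁ p) i (proj₁ q))

    sliced : Fin (suc k) → Carrierᴹ
    sliced = slice 𝓜 A (suc k) as I

    plugged : Fin (suc n) → Carrierᴹ
    plugged = plug 𝓜 A as I (suc k) (act q sliced)

    fp fq fc : Arguments
    fp = at′ plugged
    fq = at′ sliced
    fc = at′ as

    open Shift I k
    open StrictlyMonotone shift-mono
    open CompositionLabels 𝓜 (proj₁ p) I (proj₁ q)

    I<n+1 : I < suc n
    I<n+1 = toℕ<n i

    shift-last : shift (suc n) ≡ suc (n + k)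
    shift-last = shift-> I<n+1

    I+k+1≤ : I + suc k ≤ suc (n + k)
    I+k+1≤ = subst (_≤ suc (n + k)) (sym (+-suc I k)) (+-monoˡ-≤ k I<n+1)

    Lc-arc : ∀ {u w} → u < w → w ≤ suc (n + k) → Lc u w ≡ compLab (proj₁ p) I (proj₁ q) u w
    Lc-arc = lab-mk (compLab (proj₁ p) I (proj₁ q))

    inner-edge : ∀ a → suc a ≤ suc k → ¬ ⊥ → I + suc a ≡ suc (I + a) × fc (I + a) ≈ᴹ fq a
    inner-edge a a<k+1 _ = +-suc I a , ≈ᴹ-reflexive (sym (trans (at′-fromℕ< sliced a<k+1)
                                                  (cong (λ t → fc (I + t)) (toℕ-fromℕ< a<k+1))))

    inner-label : ∀ a b → Nested 0 (suc k) a b → ¬ (⊥ × b ≡ suc a) → Lc (I + a) (I + b) ≡ Lq a b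
    inner-label a b (_ , a<b , b≤k+1 , strict) _ =
      trans (Lc-arc (+-monoʳ-< I a<b) (≤-trans (+-monoʳ-≤ I b≤k+1) I+k+1≤))
      (trans (compLab-inner (m≤m+n I a) (+-monoʳ-≤ I b≤k+1) not-glued)
             (cong₂ Lq (m+n∸m≡n I a) (m+n∸m≡n I b)))
      where
        not-glued : ¬ (I + a ≡ I × I + b ≡ I + suc k)
        not-glued (I+a≡I , I+b≡) = Sum.[ (λ 0<a → <⇒≢ 0<a (sym (+-cancelˡ-≡ I a 0 I+a≡I+0)))
                                       , (λ b<k+1 → <⇒≢ b<k+1 (+-cancelˡ-≡ I b (suc k) I+b≡)) ] strict
          where
            I+a≡I+0 : I + a ≡ I + 0
            I+a≡I+0 = trans I+a≡I (sym (+-identityʳ I))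

    inner-covered : ∀ u w v → I + 0 ≤ u → u < I + v → I + v < w → w ≤ I + suc k →
                    Lc u w ≡ 𝟙 ⊎ (∃ λ u′ → I + u′ ≡ u) × (∃ λ w′ → I + w′ ≡ w)
    inner-covered u w v I+0≤u u<I+v I+v<w _ =
      inj₂ ((u ∸ I , m+[n∸m]≡n I≤u) , (w ∸ I , m+[n∸m]≡n (≤-trans I≤u (<⇒≤ (<-trans u<I+v I+v<w)))))
      where
        I≤u : I ≤ u
        I≤u = subst (_≤ u) (+-identityʳ I) I+0≤u

    module Inner = Embedding (I +_) (+-monoʳ-< I) Lq Lc fq fc (proj₂ (proj₂ q)) (proj₂ r) I+k+1≤
      (λ _ → ⊥) (λ _ → no λ ()) inner-edge (λ _ _ ()) inner-label inner-covered

    plugged-at : ∀ {t} → t < suc n →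
                 fp t ≡ (if t <ᵇ I then fc t else if t ≡ᵇ I then act q sliced else fc (t + suc k ∸ 1))
    plugged-at t<n+1 = trans (at′-fromℕ< plugged t<n+1)
      (cong (λ v → if v <ᵇ I then fc v else if v ≡ᵇ I then act q sliced else fc (v + suc k ∸ 1))
            (toℕ-fromℕ< t<n+1))

    glued-edge : ∀ a → suc a ≤ suc n → a ≡ I →
                 value Lc fc (shift a) (shift (suc a)) ≈ᴹ value Lp fp a (suc a)
    glued-edge _ _ refl = begin
      value Lc fc (shift I) (shift (suc I))
        ≡⟨ cong₂ (value Lc fc) (shift-≤ ≤-refl) shift-i+1 ⟩
      ω (Lc I (I + suc k)) (product Lc fc I (I + suc k))
        ≡⟨ cong₂ ω glued-label (cong (λ v → product Lc fc v (I + suc k)) (sym (+-identityʳ I))) ⟩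
      ω (Lp I (suc I) ⋆ Lq 0 (suc k)) (product Lc fc (I + 0) (I + suc k))
        ≈⟨ ω-cong _ (Inner.product-embeds 0 (suc k) z<s ≤-refl proj₁) ⟩
      ω (Lp I (suc I) ⋆ Lq 0 (suc k)) (product Lq fq 0 (suc k))
        ≈⟨ ω-⋆ _ _ _ ⟨
      ω (Lp I (suc I)) (act q sliced)
        ≡⟨ cong (ω (Lp I (suc I))) (trans (sym plugged-glued) (sym (product-edge Lp fp I))) ⟩
      ω (Lp I (suc I)) (product Lp fp I (suc I))
        ∎
      where
        glued-label : Lc I (I + suc k) ≡ Lp I (suc I) ⋆ Lq 0 (suc k)
        glued-label = trans (Lc-arc (m<m+n I z<s) I+k+1≤) compLab-glued

        plugged-glued : fp I ≡ act q sliced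
        plugged-glued = trans (plugged-at I<n+1)
          (trans (if-¬T λ I<ᵇI → <-irrefl refl (<ᵇ⇒< I I I<ᵇI)) (if-T (≡⇒≡ᵇ I I refl)))

    plugged-outer : ∀ {t} → t < suc n → t ≢ I → fp t ≡ fc (shift t)
    plugged-outer {t} t<n+1 t≢I with t <? I
    ... | yes t<I = trans (plugged-at t<n+1) (trans (if-T (<⇒<ᵇ t<I)) (cong fc (sym (shift-≤ (<⇒≤ t<I)))))
    ... | no t≮I  = trans (plugged-at t<n+1)
      (trans (if-¬T λ t<ᵇI → t≮I (<ᵇ⇒< t I t<ᵇI))
      (trans (if-¬T λ t≡ᵇI → t≢I (≡ᵇ⇒≡ t I t≡ᵇI))
             (cong fc (trans (cong (_∸ 1) (+-suc t k)) (sym (shift-> (≤∧≢⇒< (≮⇒≥ t≮I) (t≢I ∘ sym))))))))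

    outer-edge : ∀ a → suc a ≤ suc n → a ≢ I → shift (suc a) ≡ suc (shift a) × fc (shift a) ≈ᴹ fp a
    outer-edge a a<n+1 a≢I = shift-suc a≢I , ≈ᴹ-reflexive (sym (plugged-outer a<n+1 a≢I))

    outer-label : ∀ {a b} → a < b → b ≤ suc n → ¬ (a ≡ I × b ≡ suc a) → Lc (shift a) (shift b) ≡ Lp a b
    outer-label {a} {b} a<b b≤n+1 not-glued =
      trans (Lc-arc (shift-mono a<b) (subst (shift b ≤_) shift-last (s-mono-≤ b≤n+1)))
            (compLab-outer a<b λ { (refl , refl) → not-glued (refl , refl) })

    outer-nested-label : ∀ a b → Nested 0 (suc n) a b → ¬ (a ≡ I × b ≡ suc a) →
                         Lc (shift a) (shift b) ≡ Lp a b
    outer-nested-label a b (_ , a<b , b≤n+1 , _) = outer-label a<b b≤n+1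

    strictlyInside? : ∀ v → Dec (StrictlyInside v)
    strictlyInside? v = (I <? v) ×-dec (v <? I + suc k)

    straddling : ∀ {u w v} → u < shift v → shift v < w → w ≤ shift (suc n) →
                 StrictlyInside u ⊎ StrictlyInside w → Lc u w ≡ 𝟙
    straddling {u} {w} {v} u<sv sv<w w≤ inside =
      trans (Lc-arc (<-trans u<sv sv<w) (subst (w ≤_) shift-last w≤)) (compLab-straddling not-within inside)
      where
        not-within : ¬ (I ≤ u × w ≤ I + suc k)
        not-within (I≤u , w≤I+k+1) with shift-avoids v
        ... | inj₁ sv≤I      = <⇒≱ (≤-<-trans I≤u u<sv) sv≤I
        ... | inj₂ I+k+1≤sv  = <⇒≱ (<-≤-trans sv<w w≤I+k+1) I+k+1≤sv

    outer-covered : ∀ u w v → shift 0 ≤ u → u < shift v → shift v < w → w ≤ shift (suc n) →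
                    Lc u w ≡ 𝟙 ⊎ (∃ λ u′ → shift u′ ≡ u) × (∃ λ w′ → shift w′ ≡ w)
    outer-covered u w v _ u<sv sv<w w≤ with strictlyInside? u | strictlyInside? w
    ... | yes in-u | _         = inj₁ (straddling {v = v} u<sv sv<w w≤ (inj₁ in-u))
    ... | no _     | yes in-w  = inj₁ (straddling {v = v} u<sv sv<w w≤ (inj₂ in-w))
    ... | no out-u | no out-w  = inj₂ (shift-onto u (outside out-u) , shift-onto w (outside out-w))
      where
        outside : ∀ {v} → ¬ StrictlyInside v → v ≤ I ⊎ I + suc k ≤ v
        outside {v} not-inside with I <? v
        ... | no I≮v = inj₁ (≮⇒≥ I≮v)
        ... | yes I<v = inj₂ (≮⇒≥ λ v<I+k+1 → not-inside (I<v , v<I+k+1))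

    module Outer = Embedding shift shift-mono Lp Lc fp fc (proj₂ (proj₂ p)) (proj₂ r)
      (≤-reflexive shift-last) (_≡ I) (_≟ I) outer-edge glued-edge outer-nested-label outer-covered

    value-comp : value Lc fc 0 (suc (n + k)) ≈ᴹ value Lp fp 0 (suc n)
    value-comp = begin
      value Lc fc 0 (suc (n + k))           ≡⟨ cong₂ (value Lc fc) (shift-≤ z≤n) shift-last ⟨
      value Lc fc (shift 0) (shift (suc n)) ≈⟨ Outer.value-embeds 0 (suc n) z<s ≤-refl
                                                                   (outer-label z<s ≤-refl) ⟩
      value Lp fp 0 (suc n)                 ∎

  isNCAlgebra : IsNCAlgebra 𝓜 A act
  isNCAlgebra = record
    { act-clique = act-clique
    ; act-cong   = act-cong
    ; act-+      = λ p as j b b′ → IsLinear.additive (act-linear p as j) b b′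
    ; act-*      = λ p as j λ′ b → IsLinear.homog (act-linear p as j) λ′ b
    ; act-unit   = λ _ as → ω-𝟙 (as Fin.zero)
    ; act-comp   = λ p i q r as → Composition.value-comp p i q r as
    }

  act-triangle : ∀ (p : NCClique 2) b₁ b₂ →
                 act p (args₂ 𝓜 A b₁ b₂) ≈ᴹ
                 ω (lab (proj₁ p) 0 2) (ω (lab (proj₁ p) 0 1) b₁ ⊙ ω (lab (proj₁ p) 1 2) b₂)
  act-triangle p b₁ b₂ = ≈ᴹ-refl

theorem3p19 : {c ℓ a ℓa m : Level}
  (K : CommutativeRing c ℓ) → IsFieldOfCharZero K →
  (𝓜 : UnitaryMagma m) → Finite 𝓜 →
  (A : AssocAlgebra K a ℓa) →
  (ω : UnitaryMagma.Carrier 𝓜 → AssocAlgebra.Carrierᴹ A → AssocAlgebra.Carrierᴹ A) →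
  (∀ x → IsLinear A (ω x)) →
  (∀ b → AssocAlgebra._≈ᴹ_ A (ω (UnitaryMagma.𝟙 𝓜) b) b) →
  (∀ x y b → AssocAlgebra._≈ᴹ_ A (ω x (ω y b)) (ω (UnitaryMagma._⋆_ 𝓜 x y) b)) →
  Σ (Action 𝓜 A) (λ act → IsNCAlgebra 𝓜 A act ×
    (∀ (p : Cliques.NCClique 𝓜 2) (b₁ b₂ : AssocAlgebra.Carrierᴹ A) →
      AssocAlgebra._≈ᴹ_ A
        (act p (args₂ 𝓜 A b₁ b₂))
        (ω (Cliques.lab 𝓜 (proj₁ p) 0 2)
           (AssocAlgebra._⊙_ A (ω (Cliques.lab 𝓜 (proj₁ p) 0 1) b₁)
                               (ω (Cliques.lab 𝓜 (proj₁ p) 1 2) b₂)))))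
theorem3p19 K _ 𝓜 finite A ω ω-linear ω-𝟙 ω-⋆ = act , isNCAlgebra , act-triangle
  where
    _≟𝟙 : ∀ z → Dec (z ≡ UnitaryMagma.𝟙 𝓜)
    z ≟𝟙 = finite⇒≟ 𝓜 finite z (UnitaryMagma.𝟙 𝓜)

    open Construction {K = K} 𝓜 _≟𝟙 A ω ω-linear ω-𝟙 ω-⋆
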